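{- Let $\lambda\in A^{(n)}=\{\lambda\in\mathbb{Z}^r:\lambda_1\ge\dots\ge\lambda_r,\ \lambda_1-\lambda_r\le n\}$. Then $E^{(n)}_\lambda=x^\lambda$.
   Context: Fix integers $r\ge2$, $n\ge1$. Notation: $\epsilon_i$ standard basis of $\mathbb{R}^r$, $(\cdot,\cdot)$ standard inner product, $\Phi_+=\{\epsilon_i-\epsilon_j:i<j\}$, $\alpha_i=\epsilon_i-\epsilon_{i+1}$; $s_i$ is the transposition of coordinates $i,i+1$. Parameters: $k$ and $G_j$ ($j\in\mathbb{Z}$) with $G_0=k$, $G_jG_{ -j}=1$, $G_j$ depending only on $j$ mod $n$ (so for even $n$, $G_{n/2}=\pm1$ is a fixed sign); $k,q,G_1,\dots,G_{\lfloor(n-1)/2\rfloor}$ independent indeterminates, $\mathbb{F}^{(n)}=\mathbb{C}(k,G_1,\dots,G_{\lfloor(n-1)/2\rfloor},q)$. $\sigma(a)=k^{ -1}$ if $a\in n\mathbb{Z}_{>0}$, $\sigma(a)=G_a$ otherwise. For $\mu\in\mathbb{Z}^r$, $s\in\mathbb{Z}$, $\lambda\in\mathbb{Z}^r$: $\gamma(n\mu+sn^2\delta;\lambda)=q^{ -sn-(\mu,\lambda)}\prod_{\alpha\in\Phi_+}\sigma((\lambda,\alpha))^{(\mu,\alpha)}$. On $\mathbb{F}^{(n)}[x^{\pm1}]$ (Laurent polynomials in $x_1,\dots,x_r$, $x^\mu=\prod x_i^{\mu_i}$), with $t_n(j)=j-r_n(j)$ where $r_n(j)\in\{0,\dots,n-1\}$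 is the residue of $j$ mod $n$, define linear operators, for $1\le i\le r-1$, \[T_ix^\lambda=(k-k^{ -1})\frac{1-x^{ -t_n((\lambda,\alpha_i))\alpha_i}}{1-x^{n\alpha_i}}x^\lambda+G_{(\lambda,\alpha_i)}x^{s_i\lambda},\qquad \omega x^\lambda=q^{ -\lambda_r}x^{(\lambda_r,\lambda_1,\dots,\lambda_{r-1})}.\] These $T_i$ are invertible (they satisfy $(T_i-k)(T_i+k^{ -1})=0$). Put $Y_i=T_{i-1}^{ -1}\cdots T_1^{ -1}\,\omega\,T_{r-1}\cdots T_i$ ($1\le i\le r$). The SSV polynomials $E^{(n)}_\mu$, $\mu\in\mathbb{Z}^r$, are the unique elements of $\mathbb{F}^{(n)}[x^{\pm1}]$ whose coefficient of $x^\mu$ is $1$ and with $Y_iE^{(n)}_\mu=\gamma(n\epsilon_i;\mu)E^{(n)}_\mu$ for all $1\le i\le r$ (existence and uniqueness are known). -}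

module Defs where

open import Level using (_⊔_)
open import Algebra.Bundles using (CommutativeRing)
open import Data.Nat as ℕ using (ℕ; zero; suc; NonZero)
open import Data.Integer as ℤ using (ℤ; +_; -[1+_]; 0ℤ)
open import Data.Integer.DivMod using (_/ℕ_; _%ℕ_)
open import Data.Integer.Divisibility using () renaming (_∣_ to _∣ℤ_)
open import Data.Vec as Vec using (Vec; []; _∷_)
open import Data.Vec.Properties using (≡-dec)
open import Data.List as List using (List; []; _∷_; _++_; map; foldr; foldl; upTo; concatMap)
open import Data.Product using (_×_; _,_)
open import Data.Sum using (_⊎_)
open import Relation.Nullary using (¬_; yes; no)
open import Relation.Binary.PropositionalEquality using (_≡_)

-- Exponent vectors λ ∈ ℤ^r as Vec ℤ r.  Positions are 0-based here:
-- get λ p = λ_{p+1} of the paper (0 outside range; never used there).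

get : ∀ {m} → Vec ℤ m → ℕ → ℤ
get []       _       = 0ℤ
get (x ∷ xs) zero    = x
get (x ∷ xs) (suc p) = get xs p

set : ∀ {m} → Vec ℤ m → ℕ → ℤ → Vec ℤ m
set []       _       _ = []
set (x ∷ xs) zero    y = y ∷ xs
set (x ∷ xs) (suc p) y = x ∷ set xs p y

lastV : ∀ {m} → Vec ℤ (suc m) → ℤ
lastV (x ∷ [])     = x
lastV (x ∷ y ∷ ys) = lastV (y ∷ ys)

initV : ∀ {m} → Vec ℤ (suc m) → Vec ℤ m
initV (x ∷ [])     = []
initV (x ∷ y ∷ ys) = x ∷ initV (y ∷ ys)

rotate : ∀ {m} → Vec ℤ m → Vec ℤ m
rotate []       = []
rotate (x ∷ xs) = lastV (x ∷ xs) ∷ initV (x ∷ xs)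

-- list of naturals a, a+1, …, b (empty if b < a)
range : ℕ → ℕ → List ℕ
range a b = map (a ℕ.+_) (upTo (suc b ℕ.∸ a))

dot : ∀ {m} → Vec ℤ m → Vec ℤ m → ℤ
dot u v = Vec.foldr _ ℤ._+_ 0ℤ (Vec.zipWith ℤ._*_ u v)

-- standard basis vector ε_i (paper index i, 1-based)
ε : ∀ {m} → ℕ → Vec ℤ m
ε {m} i = set (Vec.replicate m 0ℤ) (i ℕ.∸ 1) (+ 1)

InA : (r n : ℕ) → Vec ℤ r → Set
InA r n lam =
  (∀ p → suc p ℕ.< r → get lam (suc p) ℤ.≤ get lam p)
  × (get lam 0 ℤ.- get lam (r ℕ.∸ 1) ℤ.≤ + n)

record Params {c ℓ} (R : CommutativeRing c ℓ) (n : ℕ) : Set (c ⊔ ℓ) where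
  open CommutativeRing R
  field
    k k⁻¹ q q⁻¹ : Carrier
    k-inv : k * k⁻¹ ≈ 1#
    q-inv : q * q⁻¹ ≈ 1#
    G : ℤ → Carrier
    G-zero : G 0ℤ ≈ k
    G-periodic : ∀ j → G (j ℤ.+ + n) ≈ G j
    G-inverse : ∀ j → ¬ ((+ n) ∣ℤ j) → G j * G (ℤ.- j) ≈ 1#
    G-half : ∀ h → n ≡ 2 ℕ.* h → (G (+ h) ≈ 1#) ⊎ (G (+ h) ≈ - 1#)

module SSV {c ℓ} (R : CommutativeRing c ℓ) (r n : ℕ) .{{_ : NonZero n}}
           (P : Params R n) where
  open CommutativeRing R
  open Params P

  Exp : Set
  Exp = Vec ℤ r

  -- a Laurent polynomial is a finite formal sum Σ a·x^ν
  Poly : Set c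
  Poly = List (Carrier × Exp)

  coeff : Poly → Exp → Carrier
  coeff [] μ = 0#
  coeff ((a , ν) ∷ f) μ with ≡-dec ℤ._≟_ ν μ
  ... | yes _ = a + coeff f μ
  ... | no  _ = coeff f μ

  _≈P_ : Poly → Poly → Set ℓ
  f ≈P g = ∀ μ → coeff f μ ≈ coeff g μ

  xpow : Exp → Poly
  xpow lam = (1# , lam) ∷ []

  scale : Carrier → Poly → Poly
  scale a f = map (λ { (b , ν) → (a * b , ν) }) f

  linear : (Carrier → Exp → Poly) → Poly → Poly
  linear φ f = concatMap (λ { (a , ν) → φ a ν }) f

  -- integer powers of a unit u with inverse u'
  pow : Carrier → ℕ → Carrier
  pow u zero    = 1#
  pow u (suc e) = u * pow u e

  zpow : Carrier → Carrier → ℤ → Carrier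
  zpow u u' (+ e)    = pow u e
  zpow u u' -[1+ e ] = pow u' (suc e)

  -- r_n(j) and t_n(j) = j - r_n(j) = n·(j /ℕ n)
  rn : ℤ → ℕ
  rn j = j %ℕ n

  -- (1 - y^{-m}) / (1 - y) expanded as a Laurent polynomial in y,
  -- given as a list of (coefficient, exponent of y):
  --   m = 0 : 0 ;  m = -(p+1) : 1 + y + … + y^p ;
  --   m = p+1 : -(y^{-1} + … + y^{-(p+1)})
  quotTerms : ℤ → List (Carrier × ℤ)
  quotTerms (+ zero)    = []
  quotTerms (+ suc p)   = map (λ e → (- 1# , -[1+ e ])) (upTo (suc p))
  quotTerms -[1+ p ]    = map (λ e → (1# , + e)) (upTo (suc p))

  -- ν + e·n·α_i, where α_i = ε_i - ε_{i+1} (paper index i)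
  shift : ℕ → Exp → ℤ → Exp
  shift i ν e =
    set (set ν (i ℕ.∸ 1) (get ν (i ℕ.∸ 1) ℤ.+ e ℤ.* + n))
        i (get ν i ℤ.- e ℤ.* + n)

  -- s_i ν : swap coordinates i, i+1 (paper index)
  swapV : ℕ → Exp → Exp
  swapV i ν = set (set ν (i ℕ.∸ 1) (get ν i)) i (get ν (i ℕ.∸ 1))

  pairing : ℕ → Exp → ℤ
  pairing i ν = get ν (i ℕ.∸ 1) ℤ.- get ν i

  -- T_i (1 ≤ i ≤ r-1), x^{-t_n(j) α_i} = y^{-(j /ℕ n)} with y = x^{n α_i}
  Tmono : ℕ → Carrier → Exp → Poly
  Tmono i a ν =
    map (λ { (b , e) → ((k + - k⁻¹) * (a * b) , shift i ν e) })
        (quotTerms (pairing i ν /ℕ n))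
    ++ ((a * G (pairing i ν) , swapV i ν) ∷ [])

  T : ℕ → Poly → Poly
  T i = linear (Tmono i)

  -- T_i^{-1} = T_i - (k - k^{-1})  (quadratic relation)
  Tinv : ℕ → Poly → Poly
  Tinv i f = T i f ++ scale (- (k + - k⁻¹)) f

  ω : Poly → Poly
  ω = linear (λ a ν → (a * zpow q q⁻¹ (ℤ.- get ν (r ℕ.∸ 1)) , rotate ν) ∷ [])

  -- Y_i = T_{i-1}^{-1} ⋯ T_1^{-1} ω T_{r-1} ⋯ T_i   (1 ≤ i ≤ r)
  Y : ℕ → Poly → Poly
  Y i f = foldl (λ g j → Tinv j g)
                (ω (foldl (λ g j → T j g) f (range i (r ℕ.∸ 1))))
                (range 1 (i ℕ.∸ 1))

  -- σ(a)^e ; σ(a) = k^{-1} if a ∈ nℤ_{>0}, G_a otherwise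
  -- (inverse of G_a: k^{-1} if n ∣ a (then G_a = k), G_{-a} otherwise)
  σpow : ℤ → ℤ → Carrier
  σpow a e with rn a ℕ.≟ 0 | 0ℤ ℤ.<? a
  ... | yes _ | yes _ = zpow k⁻¹ k e
  ... | yes _ | no  _ = zpow (G a) k⁻¹ e
  ... | no  _ | _     = zpow (G a) (G (ℤ.- a)) e

  -- positive roots ε_a - ε_b, a < b (0-based positions)
  posRoots : List (ℕ × ℕ)
  posRoots = concatMap (λ a → map (λ b → (a , b)) (range (suc a) (r ℕ.∸ 1)))
                       (upTo r)

  -- γ(nμ + s n² δ; λ) = q^{-sn-(μ,λ)} ∏_{α∈Φ+} σ((λ,α))^{(μ,α)}
  γ : Exp → ℤ → Exp → Carrier
  γ μ s lam =
    zpow q q⁻¹ (ℤ.- (s ℤ.* + n ℤ.+ dot μ lam))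
    * foldr _*_ 1#
        (map (λ { (a , b) → σpow (get lam a ℤ.- get lam b)
                                 (get μ a ℤ.- get μ b) })
             posRoots)

  -- The defining property of the SSV polynomial E^{(n)}_μ: coefficient of
  -- x^μ equals 1 and Y_i f = γ(n ε_i; μ) f for all 1 ≤ i ≤ r.
  -- (By the known existence/uniqueness, f = E^{(n)}_μ iff IsSSV μ f.)
  IsSSV : Exp → Poly → Set ℓ
  IsSSV μ f = (coeff f μ ≈ 1#)
            × (∀ i → 1 ℕ.≤ i → i ℕ.≤ r → Y i f ≈P scale (γ (ε i) 0ℤ μ) f)

module Submission where

-- The coefficient of x^λ in x^λ is 1, so the content is the eigenvalue
-- equation Y_{p+1} x^λ = γ(nε_{p+1}; λ) x^λ for every position p.  The key
-- observation: on a monomial x^ν with (ν, α_i) = m ∈ [0, n] the operator T_i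
-- acts as the scaled reflection x^ν ↦ σ(m) x^{s_i ν}, and on a monomial with
-- (ν, α_i) = -m, m ∈ [0, n], the inverse T_i^{-1} acts as
-- x^ν ↦ σ(m)^{-1} x^{s_i ν}.  For λ ∈ A^(n) every pairing met while computing
--   Y_{p+1} x^λ = T_p^{-1} ⋯ T_1^{-1} ω T_{r-1} ⋯ T_{p+1} x^λ
-- is of this kind: T_{p+1}, …, T_{r-1} carry λ_{p+1} to the last position,
-- ω rotates it to the front and T_1^{-1}, …, T_p^{-1} carry it back.  Hence
-- the result is a scalar multiple of x^λ, and the scalar (q^{-λ_{p+1}} times
-- one σ-factor per positive root through position p+1) is exactly γ.

open import Defs
open import Level using (_⊔_)
open import Algebra.Bundles using (CommutativeRing)
open import Data.Nat as ℕ using (ℕ; zero; suc; z≤n; s≤s; NonZero; _≤_)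
import Data.Nat.Properties as ℕP
import Data.Nat.DivMod as ℕDM
open import Data.Integer as ℤ using (ℤ; +_; -[1+_]; 0ℤ)
import Data.Integer.Properties as ℤP
open import Data.Vec as Vec using (Vec; []; _∷_)
open import Data.Vec.Properties using (≡-dec)
open import Data.List as List using (List; []; _∷_; _++_; map; foldr; foldl; length; upTo; applyUpTo; concatMap)
import Data.List.Properties as ListP
open import Data.Product using (_×_; _,_; Σ; proj₁; proj₂)
open import Data.Sum using (_⊎_; inj₁; inj₂)
open import Data.Empty using (⊥-elim)
open import Relation.Nullary using (¬_; yes; no)
open import Relation.Binary.Definitions using (tri<; tri≈; tri>)
open import Relation.Binary.PropositionalEquality as Eq using (_≡_)
import Relation.Binary.Reasoning.Setoid as SetoidReasoning

get-set-same : ∀ {m} (v : Vec ℤ m) p y → p ℕ.< m → get (set v p y) p ≡ y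
get-set-same (x ∷ v) zero    y _        = Eq.refl
get-set-same (x ∷ v) (suc p) y (s≤s lt) = get-set-same v p y lt

get-set-other : ∀ {m} (v : Vec ℤ m) p q y → ¬ q ≡ p → get (set v p y) q ≡ get v q
get-set-other []      p       q       y ne = Eq.refl
get-set-other (x ∷ v) zero    zero    y ne = ⊥-elim (ne Eq.refl)
get-set-other (x ∷ v) zero    (suc q) y ne = Eq.refl
get-set-other (x ∷ v) (suc p) zero    y ne = Eq.refl
get-set-other (x ∷ v) (suc p) (suc q) y ne = get-set-other v p q y (λ e → ne (Eq.cong suc e))

set-get : ∀ {m} (v : Vec ℤ m) p → set v p (get v p) ≡ v
set-get []      p       = Eq.refl
set-get (x ∷ v) zero    = Eq.refl
set-get (x ∷ v) (suc p) = Eq.cong (x ∷_) (set-get v p)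

get-beyond : ∀ {m} (v : Vec ℤ m) q → m ℕ.≤ q → get v q ≡ 0ℤ
get-beyond []      q       _        = Eq.refl
get-beyond (x ∷ v) (suc q) (s≤s le) = get-beyond v q le

get-extensional : ∀ {m} (u v : Vec ℤ m) → (∀ q → q ℕ.< m → get u q ≡ get v q) → u ≡ v
get-extensional []      []      _ = Eq.refl
get-extensional (x ∷ u) (y ∷ v) h =
  Eq.cong₂ _∷_ (h 0 (s≤s z≤n)) (get-extensional u v (λ q lt → h (suc q) (s≤s lt)))

get-rotate-zero : ∀ {m} (v : Vec ℤ m) → get (rotate v) 0 ≡ get v (m ℕ.∸ 1)
get-rotate-zero []      = Eq.refl
get-rotate-zero (x ∷ v) = get-lastV (x ∷ v)
  where
  get-lastV : ∀ {m} (v : Vec ℤ (suc m)) → lastV v ≡ get v m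
  get-lastV (x ∷ [])     = Eq.refl
  get-lastV (x ∷ y ∷ ys) = get-lastV (y ∷ ys)

get-rotate-suc : ∀ {m} (v : Vec ℤ m) q → suc q ℕ.< m → get (rotate v) (suc q) ≡ get v q
get-rotate-suc (x ∷ v) q (s≤s lt) = get-initV (x ∷ v) q lt
  where
  get-initV : ∀ {m} (v : Vec ℤ (suc m)) q → q ℕ.< m → get (initV v) q ≡ get v q
  get-initV (x ∷ y ∷ ys) zero    _        = Eq.refl
  get-initV (x ∷ y ∷ ys) (suc q) (s≤s lt) = get-initV (y ∷ ys) q lt

get-basis-same : ∀ {m} p → p ℕ.< m → get (ε {m} (suc p)) p ≡ + 1
get-basis-same {m} p = get-set-same (Vec.replicate m 0ℤ) p (+ 1)

get-basis-other : ∀ {m} p q → ¬ q ≡ p → get (ε {m} (suc p)) q ≡ 0ℤ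
get-basis-other {m} p q ne =
  Eq.trans (get-set-other (Vec.replicate m 0ℤ) p q (+ 1) ne) (get-replicate m q)
  where
  get-replicate : ∀ m q → get (Vec.replicate m 0ℤ) q ≡ 0ℤ
  get-replicate zero    q       = Eq.refl
  get-replicate (suc m) zero    = Eq.refl
  get-replicate (suc m) (suc q) = get-replicate m q

dot-basis : ∀ {m} (v : Vec ℤ m) p → p ℕ.< m → dot (ε (suc p)) v ≡ get v p
dot-basis (y ∷ v) zero    _        =
  Eq.trans (Eq.cong₂ ℤ._+_ (ℤP.*-identityˡ y) (dot-zero v)) (ℤP.+-identityʳ y)
  where
  dot-zero : ∀ {m} (v : Vec ℤ m) → dot (Vec.replicate m 0ℤ) v ≡ 0ℤ
  dot-zero []      = Eq.refl
  dot-zero (y ∷ v) = Eq.trans (ℤP.+-identityˡ _) (dot-zero v)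
dot-basis (y ∷ v) (suc p) (s≤s lt) = Eq.trans (ℤP.+-identityˡ _) (dot-basis v p lt)

module IntegerIdentities where
  open import Data.Integer.Tactic.RingSolver using (solve-∀)
  open import Data.Integer using (_+_; _-_; _*_; -_)

  add-neg-gap : ∀ x y → x + -[1+ 0 ] * (x - y) ≡ y
  add-neg-gap = solve-∀

  sub-neg-gap : ∀ x y → y - -[1+ 0 ] * (x - y) ≡ x
  sub-neg-gap = solve-∀

  add-zero-multiple : ∀ x t → x + + 0 * t ≡ x
  add-zero-multiple = solve-∀

  sub-zero-multiple : ∀ x t → x - + 0 * t ≡ x
  sub-zero-multiple = solve-∀

  sub-swap : ∀ x y → x - y ≡ - (y - x)
  sub-swap = solve-∀
open IntegerIdentities

consecutive : ℕ → ℕ → List ℕ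
consecutive a zero    = []
consecutive a (suc l) = a ∷ consecutive (suc a) l

applyUpTo-consecutive : ∀ (f : ℕ → ℕ) a l → (∀ x → f x ≡ a ℕ.+ x) →
                        applyUpTo f l ≡ consecutive a l
applyUpTo-consecutive f a zero    h = Eq.refl
applyUpTo-consecutive f a (suc l) h =
  Eq.cong₂ _∷_ (Eq.trans (h 0) (ℕP.+-identityʳ a))
    (applyUpTo-consecutive (λ x → f (suc x)) (suc a) l (λ x → Eq.trans (h (suc x)) (ℕP.+-suc a x)))

range-consecutive : ∀ a b → range a b ≡ consecutive a (suc b ℕ.∸ a)
range-consecutive a b =
  Eq.trans (ListP.map-applyUpTo (λ x → x) (a ℕ.+_) (suc b ℕ.∸ a))
           (applyUpTo-consecutive (a ℕ.+_) a _ (λ x → Eq.refl))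

upTo-consecutive : ∀ l → upTo l ≡ consecutive 0 l
upTo-consecutive l = applyUpTo-consecutive (λ x → x) 0 l (λ x → Eq.refl)

consecutive-++ : ∀ a l l' → consecutive a (l ℕ.+ l') ≡ consecutive a l ++ consecutive (a ℕ.+ l) l'
consecutive-++ a zero    l' = Eq.cong (λ t → consecutive t l') (Eq.sym (ℕP.+-identityʳ a))
consecutive-++ a (suc l) l' = Eq.cong (a ∷_) (Eq.trans (consecutive-++ (suc a) l l')
  (Eq.cong (λ t → consecutive (suc a) l ++ consecutive t l') (Eq.sym (ℕP.+-suc a l))))

map-consecutive-suc : ∀ {a} {A : Set a} (f : ℕ → A) s l →
                      map f (consecutive (suc s) l) ≡ map (λ x → f (suc x)) (consecutive s l)
map-consecutive-suc f s zero    = Eq.refl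
map-consecutive-suc f s (suc l) = Eq.cong (f (suc s) ∷_) (map-consecutive-suc f (suc s) l)

module Development {c ℓ} (R : CommutativeRing c ℓ) (r n : ℕ) .{{_ : NonZero n}}
                   (P : Params R n) where
  open CommutativeRing R
  open Params P
  open SSV R r n P
  open SetoidReasoning setoid
  open import Algebra.Properties.Ring ring using (-1*x≈-x; -‿distribˡ-*; -‿distribʳ-*; [y-z]x≈yx-zx)
  open import Algebra.Properties.AbelianGroup +-abelianGroup using (⁻¹-anti-homo‿-; xyx⁻¹≈y)
  open import Algebra.Properties.CommutativeSemigroup *-commutativeSemigroup using (x∙yz≈y∙xz; xy∙z≈y∙zx)

  mono : Carrier → Exp → Poly
  mono c ν = (c , ν) ∷ []

  δ : Exp → Exp → Carrier
  δ ν ρ = coeff (mono 1# ν) ρ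

  coeff-cons : ∀ a ν f ρ → coeff ((a , ν) ∷ f) ρ ≈ a * δ ν ρ + coeff f ρ
  coeff-cons a ν f ρ with ≡-dec ℤ._≟_ ν ρ
  ... | yes _ = +-congʳ (sym (trans (*-congˡ (+-identityʳ 1#)) (*-identityʳ a)))
  ... | no  _ = sym (trans (+-congʳ (zeroʳ a)) (+-identityˡ _))

  coeff-mono : ∀ a ν ρ → coeff (mono a ν) ρ ≈ a * δ ν ρ
  coeff-mono a ν ρ = trans (coeff-cons a ν [] ρ) (+-identityʳ _)

  coeff-self : ∀ a ν f → coeff ((a , ν) ∷ f) ν ≈ a + coeff f ν
  coeff-self a ν f with ≡-dec ℤ._≟_ ν ν
  ... | yes _ = refl
  ... | no ν≢ν = ⊥-elim (ν≢ν Eq.refl)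

  coeff-other : ∀ a ν f ρ → ¬ ν ≡ ρ → coeff ((a , ν) ∷ f) ρ ≈ coeff f ρ
  coeff-other a ν f ρ ν≢ρ with ≡-dec ℤ._≟_ ν ρ
  ... | yes ν≡ρ = ⊥-elim (ν≢ρ ν≡ρ)
  ... | no  _   = refl

  coeff-++ : ∀ f g ρ → coeff (f ++ g) ρ ≈ coeff f ρ + coeff g ρ
  coeff-++ []            g ρ = sym (+-identityˡ _)
  coeff-++ ((a , ν) ∷ f) g ρ = begin
    coeff ((a , ν) ∷ (f ++ g)) ρ         ≈⟨ coeff-cons a ν (f ++ g) ρ ⟩
    a * δ ν ρ + coeff (f ++ g) ρ         ≈⟨ +-congˡ (coeff-++ f g ρ) ⟩
    a * δ ν ρ + (coeff f ρ + coeff g ρ)  ≈⟨ sym (+-assoc _ _ _) ⟩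
    (a * δ ν ρ + coeff f ρ) + coeff g ρ  ≈⟨ +-congʳ (sym (coeff-cons a ν f ρ)) ⟩
    coeff ((a , ν) ∷ f) ρ + coeff g ρ    ∎

  coeff-scale : ∀ b f ρ → coeff (scale b f) ρ ≈ b * coeff f ρ
  coeff-scale b []            ρ = sym (zeroʳ b)
  coeff-scale b ((a , ν) ∷ f) ρ = begin
    coeff ((b * a , ν) ∷ scale b f) ρ    ≈⟨ coeff-cons (b * a) ν (scale b f) ρ ⟩
    b * a * δ ν ρ + coeff (scale b f) ρ  ≈⟨ +-cong (*-assoc _ _ _) (coeff-scale b f ρ) ⟩
    b * (a * δ ν ρ) + b * coeff f ρ      ≈⟨ sym (distribˡ _ _ _) ⟩
    b * (a * δ ν ρ + coeff f ρ)          ≈⟨ *-congˡ (sym (coeff-cons a ν f ρ)) ⟩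
    b * coeff ((a , ν) ∷ f) ρ            ∎

  mono-cong : ∀ {a b} ν → a ≈ b → mono a ν ≈P mono b ν
  mono-cong ν a≈b ρ = trans (coeff-mono _ ν ρ) (trans (*-congʳ a≈b) (sym (coeff-mono _ ν ρ)))

  -- weighted h f = Σ a·h(ν) over the terms a·x^ν of f.  The coefficients
  -- of a monomial-wise defined operator are of this form (coeff-linear).
  weighted : (Exp → Carrier) → Poly → Carrier
  weighted h []            = 0#
  weighted h ((a , ν) ∷ f) = a * h ν + weighted h f

  weighted-++ : ∀ h f g → weighted h (f ++ g) ≈ weighted h f + weighted h g
  weighted-++ h []            g = sym (+-identityˡ _)
  weighted-++ h ((a , ν) ∷ f) g = trans (+-congˡ (weighted-++ h f g)) (sym (+-assoc _ _ _))

  weighted-scale : ∀ h b f → weighted h (scale b f) ≈ b * weighted h f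
  weighted-scale h b []            = sym (zeroʳ b)
  weighted-scale h b ((a , ν) ∷ f) =
    trans (+-cong (*-assoc _ _ _) (weighted-scale h b f)) (sym (distribˡ _ _ _))

  without : Exp → Poly → Poly
  without ν []            = []
  without ν ((a , ρ) ∷ f) with ≡-dec ℤ._≟_ ρ ν
  ... | yes _ = without ν f
  ... | no  _ = (a , ρ) ∷ without ν f

  length-without : ∀ ν f → length (without ν f) ℕ.≤ length f
  length-without ν []            = z≤n
  length-without ν ((a , ρ) ∷ f) with ≡-dec ℤ._≟_ ρ ν
  ... | yes _ = ℕP.m≤n⇒m≤1+n (length-without ν f)
  ... | no  _ = s≤s (length-without ν f)

  coeff-without-same : ∀ ν f → coeff (without ν f) ν ≈ 0#
  coeff-without-same ν []            = refl
  coeff-without-same ν ((a , ρ) ∷ f) with ≡-dec ℤ._≟_ ρ ν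
  ... | yes _   = coeff-without-same ν f
  ... | no  ρ≢ν = trans (coeff-other a ρ (without ν f) ν ρ≢ν) (coeff-without-same ν f)

  coeff-without-other : ∀ ν f μ → ¬ μ ≡ ν → coeff (without ν f) μ ≈ coeff f μ
  coeff-without-other ν []            μ μ≢ν = refl
  coeff-without-other ν ((a , ρ) ∷ f) μ μ≢ν with ≡-dec ℤ._≟_ ρ ν
  ... | yes ρ≡ν = trans (coeff-without-other ν f μ μ≢ν)
                    (sym (coeff-other a ρ f μ (λ ρ≡μ → μ≢ν (Eq.trans (Eq.sym ρ≡μ) ρ≡ν))))
  ... | no  _   = trans (coeff-cons a ρ (without ν f) μ)
                    (trans (+-congˡ (coeff-without-other ν f μ μ≢ν)) (sym (coeff-cons a ρ f μ)))

  weighted-split : ∀ h ν f → weighted h f ≈ coeff f ν * h ν + weighted h (without ν f)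
  weighted-split h ν []            = sym (trans (+-identityʳ _) (zeroˡ _))
  weighted-split h ν ((a , ρ) ∷ f) with ≡-dec ℤ._≟_ ρ ν
  ... | yes Eq.refl = begin
      a * h ρ + weighted h f                                   ≈⟨ +-congˡ (weighted-split h ρ f) ⟩
      a * h ρ + (coeff f ρ * h ρ + weighted h (without ρ f))   ≈⟨ sym (+-assoc _ _ _) ⟩
      (a * h ρ + coeff f ρ * h ρ) + weighted h (without ρ f)   ≈⟨ +-congʳ (sym (distribʳ _ _ _)) ⟩
      (a + coeff f ρ) * h ρ + weighted h (without ρ f)         ∎
  ... | no _ = begin
      a * h ρ + weighted h f                                   ≈⟨ +-congˡ (weighted-split h ν f) ⟩
      a * h ρ + (coeff f ν * h ν + weighted h (without ν f))   ≈⟨ sym (+-assoc _ _ _) ⟩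
      (a * h ρ + coeff f ν * h ν) + weighted h (without ν f)   ≈⟨ +-congʳ (+-comm _ _) ⟩
      (coeff f ν * h ν + a * h ρ) + weighted h (without ν f)   ≈⟨ +-assoc _ _ _ ⟩
      coeff f ν * h ν + (a * h ρ + weighted h (without ν f))   ∎

  -- A representation of the zero polynomial has weighted sum zero
  -- (induction on the number of terms, fuelled by `bound`).
  weighted-null : ∀ bound h f → length f ℕ.≤ bound → (∀ μ → coeff f μ ≈ 0#) → weighted h f ≈ 0#
  weighted-null bound       h []            _        _   = refl
  weighted-null (suc bound) h ((a , ν) ∷ f) (s≤s le) f≈0 = begin
    a * h ν + weighted h f                                   ≈⟨ +-congˡ (weighted-split h ν f) ⟩
    a * h ν + (coeff f ν * h ν + weighted h (without ν f))   ≈⟨ sym (+-assoc _ _ _) ⟩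
    (a * h ν + coeff f ν * h ν) + weighted h (without ν f)   ≈⟨ +-congʳ (sym (distribʳ _ _ _)) ⟩
    (a + coeff f ν) * h ν + weighted h (without ν f)         ≈⟨ +-cong (*-congʳ coeff-ν≈0) rest-sum≈0 ⟩
    0# * h ν + 0#                                            ≈⟨ trans (+-identityʳ _) (zeroˡ _) ⟩
    0#                                                       ∎
    where
    coeff-ν≈0 : a + coeff f ν ≈ 0#
    coeff-ν≈0 = trans (sym (coeff-self a ν f)) (f≈0 ν)
    rest≈0 : ∀ μ → coeff (without ν f) μ ≈ 0#
    rest≈0 μ with ≡-dec ℤ._≟_ μ ν
    ... | yes Eq.refl = coeff-without-same μ f
    ... | no  μ≢ν     = trans (coeff-without-other ν f μ μ≢ν)
                          (trans (sym (coeff-other a ν f μ (λ ν≡μ → μ≢ν (Eq.sym ν≡μ)))) (f≈0 μ))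
    rest-sum≈0 : weighted h (without ν f) ≈ 0#
    rest-sum≈0 = weighted-null bound h (without ν f) (ℕP.≤-trans (length-without ν f) le) rest≈0

  weighted-resp : ∀ h {f g} → f ≈P g → weighted h f ≈ weighted h g
  weighted-resp h {f} {g} f≈g = begin
    weighted h f                              ≈⟨ sym (+-identityʳ _) ⟩
    weighted h f + 0#                         ≈⟨ +-congˡ (sym (-‿inverseˡ (weighted h g))) ⟩
    weighted h f + (- weighted h g + weighted h g)
                                              ≈⟨ sym (+-assoc _ _ _) ⟩
    (weighted h f + - weighted h g) + weighted h g
                                              ≈⟨ +-congʳ difference≈0 ⟩
    0# + weighted h g                         ≈⟨ +-identityˡ _ ⟩
    weighted h g                              ∎
    where
    difference : Poly
    difference = f ++ scale (- 1#) g
    coeff-difference : ∀ μ → coeff difference μ ≈ 0#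
    coeff-difference μ = begin
      coeff difference μ                       ≈⟨ coeff-++ f _ μ ⟩
      coeff f μ + coeff (scale (- 1#) g) μ     ≈⟨ +-cong (f≈g μ) (coeff-scale _ g μ) ⟩
      coeff g μ + - 1# * coeff g μ             ≈⟨ +-congˡ (-1*x≈-x _) ⟩
      coeff g μ + - coeff g μ                  ≈⟨ -‿inverseʳ _ ⟩
      0#                                       ∎
    difference≈0 : weighted h f + - weighted h g ≈ 0#
    difference≈0 = begin
      weighted h f + - weighted h g            ≈⟨ +-congˡ (sym (-1*x≈-x _)) ⟩
      weighted h f + - 1# * weighted h g       ≈⟨ +-congˡ (sym (weighted-scale h (- 1#) g)) ⟩
      weighted h f + weighted h (scale (- 1#) g)
                                               ≈⟨ sym (weighted-++ h f _) ⟩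
      weighted h difference                    ≈⟨ weighted-null (length difference) h difference ℕP.≤-refl coeff-difference ⟩
      0#                                       ∎

  ScalarLinear : (Carrier → Exp → Poly) → Set (c ⊔ ℓ)
  ScalarLinear φ = ∀ a ν ρ → coeff (φ a ν) ρ ≈ a * coeff (φ 1# ν) ρ

  coeff-linear : ∀ φ → ScalarLinear φ → ∀ f ρ → coeff (linear φ f) ρ ≈ weighted (λ ν → coeff (φ 1# ν) ρ) f
  coeff-linear φ lin []            ρ = refl
  coeff-linear φ lin ((a , ν) ∷ f) ρ =
    trans (coeff-++ (φ a ν) (linear φ f) ρ) (+-cong (lin a ν ρ) (coeff-linear φ lin f ρ))

  linear-resp : ∀ φ → ScalarLinear φ → ∀ {f g} → f ≈P g → linear φ f ≈P linear φ g
  linear-resp φ lin {f} {g} f≈g ρ =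
    trans (coeff-linear φ lin f ρ) (trans (weighted-resp _ {f} {g} f≈g) (sym (coeff-linear φ lin g ρ)))

  get-swap-left : ∀ (v : Exp) j → suc j ℕ.< r → get (swapV (suc j) v) j ≡ get v (suc j)
  get-swap-left v j lt =
    Eq.trans (get-set-other (set v j (get v (suc j))) (suc j) j (get v j) (ℕP.<⇒≢ (ℕP.n<1+n j)))
             (get-set-same v j (get v (suc j)) (ℕP.<-trans (ℕP.n<1+n j) lt))

  get-swap-right : ∀ (v : Exp) j → suc j ℕ.< r → get (swapV (suc j) v) (suc j) ≡ get v j
  get-swap-right v j lt = get-set-same (set v j (get v (suc j))) (suc j) (get v j) lt

  get-swap-other : ∀ (v : Exp) j q → ¬ q ≡ j → ¬ q ≡ suc j → get (swapV (suc j) v) q ≡ get v q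
  get-swap-other v j q q≢j q≢j+1 =
    Eq.trans (get-set-other (set v j (get v (suc j))) (suc j) q (get v j) q≢j+1)
             (get-set-other v j q (get v (suc j)) q≢j)

  set-both : ∀ i (ν : Exp) {x y} → x ≡ get ν (i ℕ.∸ 1) → y ≡ get ν i → set (set ν (i ℕ.∸ 1) x) i y ≡ ν
  set-both i ν {x} {y} Eq.refl Eq.refl =
    Eq.trans (Eq.cong (λ w → set w i (get ν i)) (set-get ν (i ℕ.∸ 1))) (set-get ν i)

  swap-fixed : ∀ i ν → pairing i ν ≡ + 0 → swapV i ν ≡ ν
  swap-fixed i ν e = set-both i ν (Eq.sym equal) equal
    where
    equal : get ν (i ℕ.∸ 1) ≡ get ν i
    equal = ℤP.i-j≡0⇒i≡j _ _ e

  shift-zero : ∀ i ν → shift i ν (+ 0) ≡ ν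
  shift-zero i ν = set-both i ν (add-zero-multiple _ (+ n)) (sub-zero-multiple _ (+ n))

  shift-period : ∀ i ν → pairing i ν ≡ + n → shift i ν -[1+ 0 ] ≡ swapV i ν
  shift-period i ν e = Eq.cong₂ (λ x y → set (set ν (i ℕ.∸ 1) x) i y)
    (Eq.trans (Eq.cong (λ t → get ν (i ℕ.∸ 1) ℤ.+ -[1+ 0 ] ℤ.* t) (Eq.sym e)) (add-neg-gap (get ν (i ℕ.∸ 1)) (get ν i)))
    (Eq.trans (Eq.cong (λ t → get ν i ℤ.- -[1+ 0 ] ℤ.* t) (Eq.sym e)) (sub-neg-gap (get ν (i ℕ.∸ 1)) (get ν i)))

  quotient-small : ∀ {m} → m ℕ.< n → (+ m) ℤ./ℕ n ≡ + 0
  quotient-small lt = Eq.cong +_ (ℕDM.m<n⇒m/n≡0 lt)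

  quotient-period : (+ n) ℤ./ℕ n ≡ + 1
  quotient-period = Eq.cong +_ (ℕDM.n/n≡1 n)

  quotient-negative : ∀ {m} → suc m ℕ.≤ n → -[1+ m ] ℤ./ℕ n ≡ -[1+ 0 ]
  quotient-negative {m} le with suc m ℕ.% n in eq | ℕP.m≤n⇒m<n∨m≡n le
  ... | zero  | inj₁ lt      = ⊥-elim (ℕP.0≢1+n (Eq.trans (Eq.sym eq) (ℕDM.m<n⇒m%n≡m lt)))
  ... | zero  | inj₂ Eq.refl = Eq.cong (λ t → ℤ.- (+ t)) (ℕDM.n/n≡1 n)
  ... | suc _ | inj₁ lt      = Eq.cong -[1+_] (ℕDM.m<n⇒m/n≡0 lt)
  ... | suc _ | inj₂ Eq.refl = ⊥-elim (ℕP.0≢1+n (Eq.trans (Eq.sym (ℕDM.n%n≡0 n)) eq))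

  σpow-cases : ∀ a e →
      (rn a ≡ 0 × 0ℤ ℤ.< a × σpow a e ≈ zpow k⁻¹ k e)
    ⊎ (rn a ≡ 0 × ¬ (0ℤ ℤ.< a) × σpow a e ≈ zpow (G a) k⁻¹ e)
    ⊎ (¬ rn a ≡ 0 × σpow a e ≈ zpow (G a) (G (ℤ.- a)) e)
  σpow-cases a e with rn a ℕ.≟ 0 | 0ℤ ℤ.<? a
  ... | yes a≡0 | yes 0<a = inj₁ (a≡0 , 0<a , refl)
  ... | yes a≡0 | no  0≮a = inj₂ (inj₁ (a≡0 , 0≮a , refl))
  ... | no  a≢0 | _       = inj₂ (inj₂ (a≢0 , refl))

  0<n : 0ℤ ℤ.< + n
  0<n = ℤ.+<+ (ℕ.>-nonZero⁻¹ n)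

  rn-small : ∀ {m} → m ℕ.< n → rn (+ m) ≡ m
  rn-small = ℕDM.m<n⇒m%n≡m

  σ-exponent-zero : ∀ a → σpow a (+ 0) ≈ 1#
  σ-exponent-zero a with σpow-cases a (+ 0)
  ... | inj₁ (_ , _ , e)        = e
  ... | inj₂ (inj₁ (_ , _ , e)) = e
  ... | inj₂ (inj₂ (_ , e))     = e

  σ-forward-small : ∀ {m} → m ℕ.< n → σpow (+ m) (+ 1) ≈ G (+ m)
  σ-forward-small {m} lt with σpow-cases (+ m) (+ 1)
  ... | inj₁ (m≡0 , ℤ.+<+ 0<m , _) = ⊥-elim (ℕP.<⇒≢ 0<m (Eq.sym (Eq.trans (Eq.sym (rn-small lt)) m≡0)))
  ... | inj₂ (inj₁ (_ , _ , e))     = trans e (*-identityʳ _)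
  ... | inj₂ (inj₂ (_ , e))         = trans e (*-identityʳ _)

  σ-forward-period : σpow (+ n) (+ 1) ≈ k⁻¹
  σ-forward-period with σpow-cases (+ n) (+ 1)
  ... | inj₁ (_ , _ , e)          = trans e (*-identityʳ _)
  ... | inj₂ (inj₁ (_ , 0≮n , _)) = ⊥-elim (0≮n 0<n)
  ... | inj₂ (inj₂ (n≢0 , _))     = ⊥-elim (n≢0 (ℕDM.n%n≡0 n))

  σ-backward-zero : σpow (+ 0) -[1+ 0 ] ≈ k⁻¹
  σ-backward-zero with σpow-cases (+ 0) -[1+ 0 ]
  ... | inj₁ (_ , ℤ.+<+ () , _)
  ... | inj₂ (inj₁ (_ , _ , e)) = trans e (*-identityʳ _)
  ... | inj₂ (inj₂ (0≢0 , _))   = ⊥-elim (0≢0 (rn-small (ℕ.>-nonZero⁻¹ n)))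

  -- For 0 < m ≤ n: σ(m)^{-1} = G_{-m}, using G_{-n} = G_0 = k in the case m = n.
  σ-backward-positive : ∀ {m} → suc m ℕ.≤ n → σpow (+ suc m) -[1+ 0 ] ≈ G -[1+ m ]
  σ-backward-positive {m} le with σpow-cases (+ suc m) -[1+ 0 ] | ℕP.m≤n⇒m<n∨m≡n le
  ... | inj₁ (m≡0 , _ , _)        | inj₁ lt = ⊥-elim (ℕP.1+n≢0 (Eq.trans (Eq.sym (rn-small lt)) m≡0))
  ... | inj₂ (inj₁ (m≡0 , _ , _)) | inj₁ lt = ⊥-elim (ℕP.1+n≢0 (Eq.trans (Eq.sym (rn-small lt)) m≡0))
  ... | inj₂ (inj₂ (_ , e))       | inj₁ _  = trans e (*-identityʳ _)
  ... | inj₁ (_ , _ , e)          | inj₂ Eq.refl = trans (trans e (*-identityʳ _)) (sym G-minus-period)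
    where
    G-minus-period : G (ℤ.- (+ n)) ≈ k
    G-minus-period = trans (sym (G-periodic (ℤ.- (+ n))))
                           (trans (reflexive (Eq.cong G (ℤP.+-inverseˡ (+ n)))) G-zero)
  ... | inj₂ (inj₁ (_ , 0≮n , _)) | inj₂ Eq.refl = ⊥-elim (0≮n 0<n)
  ... | inj₂ (inj₂ (n≢0 , _))     | inj₂ Eq.refl = ⊥-elim (n≢0 (ℕDM.n%n≡0 n))

  K : Carrier
  K = k + - k⁻¹

  -- a x - (x - y) a = a y, the cancellation giving the eigenvalue k⁻¹.
  cancel-difference : ∀ x y a → a * x + - ((x + - y) * a) ≈ a * y
  cancel-difference x y a = begin
    a * x + - ((x + - y) * a)         ≈⟨ +-congˡ (-‿cong ([y-z]x≈yx-zx a x y)) ⟩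
    a * x + - (x * a + - (y * a))     ≈⟨ +-congˡ (⁻¹-anti-homo‿- _ _) ⟩
    a * x + (y * a + - (x * a))       ≈⟨ +-cong (*-comm a x) (+-congʳ (*-comm y a)) ⟩
    x * a + (a * y + - (x * a))       ≈⟨ sym (+-assoc _ _ _) ⟩
    x * a + a * y + - (x * a)         ≈⟨ xyx⁻¹≈y _ _ ⟩
    a * y                             ∎

  -- T_i x^ν when (ν, α_i) = n:  -K a + a k = a k⁻¹.
  period-eigenvalue : ∀ a → K * (a * - 1#) + a * k ≈ a * k⁻¹
  period-eigenvalue a = begin
    K * (a * - 1#) + a * k            ≈⟨ +-comm _ _ ⟩
    a * k + K * (a * - 1#)            ≈⟨ +-congˡ (*-congˡ (trans (*-comm a (- 1#)) (-1*x≈-x a))) ⟩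
    a * k + K * - a                   ≈⟨ +-congˡ (sym (-‿distribʳ-* K a)) ⟩
    a * k + - (K * a)                 ≈⟨ cancel-difference k k⁻¹ a ⟩
    a * k⁻¹                           ∎

  -- T_i^{-1} x^ν when (ν, α_i) = 0:  a k - K a = a k⁻¹.
  fixed-eigenvalue : ∀ a → a * k + (- K) * a ≈ a * k⁻¹
  fixed-eigenvalue a = trans (+-congˡ (sym (-‿distribˡ-* K a))) (cancel-difference k k⁻¹ a)

  -- T_i^{-1} x^ν when (ν, α_i) < 0: the quotient term K a x^ν cancels.
  quotient-cancels : ∀ a → K * (a * 1#) + (- K) * a ≈ 0#
  quotient-cancels a = begin
    K * (a * 1#) + (- K) * a          ≈⟨ +-cong (*-congˡ (*-identityʳ a)) (sym (-‿distribˡ-* K a)) ⟩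
    K * a + - (K * a)                 ≈⟨ -‿inverseʳ _ ⟩
    0#                                ∎

  quotientTerm : Carrier → ℕ → Exp → Carrier × ℤ → Carrier × Exp
  quotientTerm a i ν (b , e) = (K * (a * b) , shift i ν e)

  coeff-mono-factor : ∀ {a b b'} ν ρ → b ≈ a * b' → coeff (mono b ν) ρ ≈ a * coeff (mono b' ν) ρ
  coeff-mono-factor ν ρ b≈ab' = begin
    coeff (mono _ ν) ρ                ≈⟨ coeff-mono _ ν ρ ⟩
    _ * δ ν ρ                         ≈⟨ *-congʳ b≈ab' ⟩
    _ * _ * δ ν ρ                     ≈⟨ *-assoc _ _ _ ⟩
    _ * (_ * δ ν ρ)                   ≈⟨ *-congˡ (sym (coeff-mono _ ν ρ)) ⟩
    _ * coeff (mono _ ν) ρ            ∎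

  factor-unit : ∀ a b → a * b ≈ a * (1# * b)
  factor-unit a b = *-congˡ (sym (*-identityˡ b))

  coeff-quotient-linear : ∀ a i ν qs ρ →
    coeff (map (quotientTerm a i ν) qs) ρ ≈ a * coeff (map (quotientTerm 1# i ν) qs) ρ
  coeff-quotient-linear a i ν []            ρ = sym (zeroʳ a)
  coeff-quotient-linear a i ν ((b , e) ∷ qs) ρ = begin
    coeff (mono (K * (a * b)) ν' ++ rest a) ρ                     ≈⟨ coeff-++ (mono _ ν') (rest a) ρ ⟩
    coeff (mono (K * (a * b)) ν') ρ + coeff (rest a) ρ
      ≈⟨ +-cong (coeff-mono-factor ν' ρ regroup) (coeff-quotient-linear a i ν qs ρ) ⟩
    a * coeff (mono (K * (1# * b)) ν') ρ + a * coeff (rest 1#) ρ  ≈⟨ sym (distribˡ _ _ _) ⟩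
    a * (coeff (mono (K * (1# * b)) ν') ρ + coeff (rest 1#) ρ)    ≈⟨ *-congˡ (sym (coeff-++ (mono _ ν') (rest 1#) ρ)) ⟩
    a * coeff (mono (K * (1# * b)) ν' ++ rest 1#) ρ               ∎
    where
    ν' = shift i ν e
    rest : Carrier → Poly
    rest a' = map (quotientTerm a' i ν) qs
    regroup : K * (a * b) ≈ a * (K * (1# * b))
    regroup = trans (x∙yz≈y∙xz K a b) (*-congˡ (*-congˡ (sym (*-identityˡ b))))

  T-scalarLinear : ∀ i → ScalarLinear (Tmono i)
  T-scalarLinear i a ν ρ = begin
    coeff (quotient a ++ reflected a) ρ                         ≈⟨ coeff-++ (quotient a) (reflected a) ρ ⟩
    coeff (quotient a) ρ + coeff (reflected a) ρ
      ≈⟨ +-cong (coeff-quotient-linear a i ν qs ρ) (coeff-mono-factor (swapV i ν) ρ (factor-unit a g)) ⟩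
    a * coeff (quotient 1#) ρ + a * coeff (reflected 1#) ρ      ≈⟨ sym (distribˡ _ _ _) ⟩
    a * (coeff (quotient 1#) ρ + coeff (reflected 1#) ρ)        ≈⟨ *-congˡ (sym (coeff-++ (quotient 1#) (reflected 1#) ρ)) ⟩
    a * coeff (quotient 1# ++ reflected 1#) ρ                   ∎
    where
    qs = quotTerms (pairing i ν ℤ./ℕ n)
    g = G (pairing i ν)
    quotient reflected : Carrier → Poly
    quotient a'  = map (quotientTerm a' i ν) qs
    reflected a' = mono (a' * g) (swapV i ν)

  T-resp : ∀ i {f g} → f ≈P g → T i f ≈P T i g
  T-resp i {f} {g} = linear-resp (Tmono i) (T-scalarLinear i) {f} {g}

  Tinv-resp : ∀ i {f g} → f ≈P g → Tinv i f ≈P Tinv i g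
  Tinv-resp i {f} {g} f≈g ρ = begin
    coeff (T i f ++ scale (- K) f) ρ          ≈⟨ coeff-++ (T i f) _ ρ ⟩
    coeff (T i f) ρ + coeff (scale (- K) f) ρ ≈⟨ +-cong (T-resp i {f} {g} f≈g ρ) (coeff-scale _ f ρ) ⟩
    coeff (T i g) ρ + - K * coeff f ρ         ≈⟨ +-congˡ (*-congˡ (f≈g ρ)) ⟩
    coeff (T i g) ρ + - K * coeff g ρ         ≈⟨ +-congˡ (sym (coeff-scale _ g ρ)) ⟩
    coeff (T i g) ρ + coeff (scale (- K) g) ρ ≈⟨ sym (coeff-++ (T i g) _ ρ) ⟩
    coeff (T i g ++ scale (- K) g) ρ          ∎

  ωmono : Carrier → Exp → Poly
  ωmono a ν = mono (a * zpow q q⁻¹ (ℤ.- get ν (r ℕ.∸ 1))) (rotate ν)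

  ω-resp : ∀ {f g} → f ≈P g → ω f ≈P ω g
  ω-resp {f} {g} = linear-resp ωmono (λ a ν ρ → coeff-mono-factor (rotate ν) ρ (factor-unit a _)) {f} {g}

  ω-mono : ∀ a ν → ω (mono a ν) ≈P ωmono a ν
  ω-mono a ν ρ = trans (coeff-++ (ωmono a ν) [] ρ) (+-identityʳ _)

  coeff-T-mono : ∀ i a ν {j d} → pairing i ν ≡ j → j ℤ./ℕ n ≡ d → ∀ ρ →
    coeff (T i (mono a ν)) ρ ≈ coeff (map (quotientTerm a i ν) (quotTerms d)) ρ + a * G j * δ (swapV i ν) ρ
  coeff-T-mono i a ν Eq.refl Eq.refl ρ = begin
    coeff (Tmono i a ν ++ []) ρ                 ≈⟨ coeff-++ (Tmono i a ν) [] ρ ⟩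
    coeff (Tmono i a ν) ρ + 0#                  ≈⟨ +-identityʳ _ ⟩
    coeff (quotient ++ mono (a * g) sν) ρ       ≈⟨ coeff-++ quotient (mono (a * g) sν) ρ ⟩
    coeff quotient ρ + coeff (mono (a * g) sν) ρ ≈⟨ +-congˡ (coeff-mono (a * g) sν ρ) ⟩
    coeff quotient ρ + a * g * δ sν ρ           ∎
    where
    g = G (pairing i ν)
    sν = swapV i ν
    quotient = map (quotientTerm a i ν) (quotTerms (pairing i ν ℤ./ℕ n))

  coeff-Tinv-mono : ∀ i a ν ρ → coeff (Tinv i (mono a ν)) ρ ≈ coeff (T i (mono a ν)) ρ + (- K) * a * δ ν ρ
  coeff-Tinv-mono i a ν ρ = trans (coeff-++ (T i (mono a ν)) _ ρ) (+-congˡ (coeff-mono _ ν ρ))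

  T-forward : ∀ i a ν m → pairing i ν ≡ + m → m ℕ.≤ n →
              T i (mono a ν) ≈P mono (a * σpow (+ m) (+ 1)) (swapV i ν)
  T-forward i a ν m e le ρ with ℕP.m≤n⇒m<n∨m≡n le
  ... | inj₁ m<n = begin
    coeff (T i (mono a ν)) ρ          ≈⟨ coeff-T-mono i a ν e (quotient-small m<n) ρ ⟩
    0# + a * G (+ m) * d              ≈⟨ +-identityˡ _ ⟩
    a * G (+ m) * d                   ≈⟨ *-congʳ (*-congˡ (sym (σ-forward-small m<n))) ⟩
    a * σpow (+ m) (+ 1) * d          ≈⟨ sym (coeff-mono _ (swapV i ν) ρ) ⟩
    coeff (mono (a * σpow (+ m) (+ 1)) (swapV i ν)) ρ ∎
    where d = δ (swapV i ν) ρ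
  ... | inj₂ Eq.refl = begin
    coeff (T i (mono a ν)) ρ          ≈⟨ coeff-T-mono i a ν e quotient-period ρ ⟩
    coeff (mono (K * (a * - 1#)) (shift i ν -[1+ 0 ])) ρ + a * G (+ m) * d
                                      ≈⟨ +-congʳ (reflexive (Eq.cong (λ w → coeff (mono (K * (a * - 1#)) w) ρ) (shift-period i ν e))) ⟩
    coeff (mono (K * (a * - 1#)) (swapV i ν)) ρ + a * G (+ m) * d
                                      ≈⟨ +-congʳ (coeff-mono _ (swapV i ν) ρ) ⟩
    K * (a * - 1#) * d + a * G (+ m) * d
                                      ≈⟨ sym (distribʳ d _ _) ⟩
    (K * (a * - 1#) + a * G (+ m)) * d
                                      ≈⟨ *-congʳ (+-congˡ (*-congˡ G-period)) ⟩
    (K * (a * - 1#) + a * k) * d      ≈⟨ *-congʳ (trans (period-eigenvalue a) (*-congˡ (sym σ-forward-period))) ⟩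
    a * σpow (+ m) (+ 1) * d          ≈⟨ sym (coeff-mono _ (swapV i ν) ρ) ⟩
    coeff (mono (a * σpow (+ m) (+ 1)) (swapV i ν)) ρ ∎
    where
    d = δ (swapV i ν) ρ
    G-period : G (+ n) ≈ k
    G-period = trans (G-periodic 0ℤ) G-zero

  T-backward : ∀ i a ν m → pairing i ν ≡ ℤ.- (+ m) → m ℕ.≤ n →
               Tinv i (mono a ν) ≈P mono (a * σpow (+ m) -[1+ 0 ]) (swapV i ν)
  T-backward i a ν zero e _ ρ = begin
    coeff (Tinv i (mono a ν)) ρ                      ≈⟨ coeff-Tinv-mono i a ν ρ ⟩
    coeff (T i (mono a ν)) ρ + (- K) * a * δ ν ρ     ≈⟨ +-congʳ (coeff-T-mono i a ν e (quotient-small (ℕ.>-nonZero⁻¹ n)) ρ) ⟩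
    (0# + a * G (+ 0) * δ (swapV i ν) ρ) + (- K) * a * δ ν ρ
                                                     ≈⟨ +-congʳ (+-identityˡ _) ⟩
    a * G (+ 0) * δ (swapV i ν) ρ + (- K) * a * δ ν ρ
                                                     ≈⟨ +-congʳ (*-congˡ (reflexive (Eq.cong (λ w → δ w ρ) fixed))) ⟩
    a * G (+ 0) * δ ν ρ + (- K) * a * δ ν ρ          ≈⟨ sym (distribʳ _ _ _) ⟩
    (a * G (+ 0) + (- K) * a) * δ ν ρ                ≈⟨ *-congʳ (+-congʳ (*-congˡ G-zero)) ⟩
    (a * k + (- K) * a) * δ ν ρ                      ≈⟨ *-congʳ (trans (fixed-eigenvalue a) (*-congˡ (sym σ-backward-zero))) ⟩
    a * σpow (+ 0) -[1+ 0 ] * δ ν ρ                  ≈⟨ sym (coeff-mono _ ν ρ) ⟩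
    coeff (mono (a * σpow (+ 0) -[1+ 0 ]) ν) ρ       ≈⟨ reflexive (Eq.cong (λ w → coeff (mono (a * σpow (+ 0) -[1+ 0 ]) w) ρ) (Eq.sym fixed)) ⟩
    coeff (mono (a * σpow (+ 0) -[1+ 0 ]) (swapV i ν)) ρ ∎
    where fixed = swap-fixed i ν e
  T-backward i a ν (suc m) e le ρ = begin
    coeff (Tinv i (mono a ν)) ρ                      ≈⟨ coeff-Tinv-mono i a ν ρ ⟩
    coeff (T i (mono a ν)) ρ + (- K) * a * δ ν ρ     ≈⟨ +-congʳ (coeff-T-mono i a ν e (quotient-negative le) ρ) ⟩
    (coeff (mono (K * (a * 1#)) (shift i ν (+ 0))) ρ + a * G -[1+ m ] * d) + (- K) * a * δ ν ρ
      ≈⟨ +-congʳ (+-congʳ (trans (reflexive (Eq.cong (λ w → coeff (mono (K * (a * 1#)) w) ρ) (shift-zero i ν))) (coeff-mono _ ν ρ))) ⟩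
    (K * (a * 1#) * δ ν ρ + a * G -[1+ m ] * d) + (- K) * a * δ ν ρ
                                                     ≈⟨ +-congʳ (+-comm _ _) ⟩
    (a * G -[1+ m ] * d + K * (a * 1#) * δ ν ρ) + (- K) * a * δ ν ρ
                                                     ≈⟨ +-assoc _ _ _ ⟩
    a * G -[1+ m ] * d + (K * (a * 1#) * δ ν ρ + (- K) * a * δ ν ρ)
                                                     ≈⟨ +-congˡ (sym (distribʳ _ _ _)) ⟩
    a * G -[1+ m ] * d + (K * (a * 1#) + (- K) * a) * δ ν ρ
                                                     ≈⟨ +-congˡ (trans (*-congʳ (quotient-cancels a)) (zeroˡ _)) ⟩
    a * G -[1+ m ] * d + 0#                          ≈⟨ +-identityʳ _ ⟩
    a * G -[1+ m ] * d                               ≈⟨ *-congʳ (*-congˡ (sym (σ-backward-positive le))) ⟩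
    a * σpow (+ suc m) -[1+ 0 ] * d                  ≈⟨ sym (coeff-mono _ (swapV i ν) ρ) ⟩
    coeff (mono (a * σpow (+ suc m) -[1+ 0 ]) (swapV i ν)) ρ ∎
    where d = δ (swapV i ν) ρ

  product : List Carrier → Carrier
  product = foldr _*_ 1#

  module Sweep (Op : ℕ → Poly → Poly) (Op-resp : ∀ j {f g} → f ≈P g → Op j f ≈P Op j g)
               (Shape : ℕ → Exp → Set) (w : ℕ → Carrier) (bound : ℕ)
               (step : ∀ s v c → s ℕ.< bound → Shape s v →
                         Shape (suc s) (swapV (suc s) v)
                         × Op (suc s) (mono c v) ≈P mono (c * w (suc s)) (swapV (suc s) v)) where

    sweep : ∀ l s v f c → s ℕ.+ l ℕ.≤ bound → Shape s v → f ≈P mono c v →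
            Σ Exp λ v' → Shape (s ℕ.+ l) v'
              × foldl (λ g j → Op j g) f (consecutive (suc s) l) ≈P mono (c * product (map w (consecutive (suc s) l))) v'
    sweep zero s v f c _ shape f≈cv =
      v , Eq.subst (λ t → Shape t v) (Eq.sym (ℕP.+-identityʳ s)) shape ,
      λ ρ → trans (f≈cv ρ) (mono-cong v (sym (*-identityʳ c)) ρ)
    sweep (suc l) s v f c s+l<bound shape f≈cv
      with step s v c (ℕP.<-≤-trans (ℕP.m<m+n s (s≤s z≤n)) s+l<bound) shape
    ... | shape₁ , Op≈ with sweep l (suc s) (swapV (suc s) v) (Op (suc s) f) (c * w (suc s))
                              (Eq.subst (ℕ._≤ bound) (ℕP.+-suc s l) s+l<bound) shape₁
                              (λ ρ → trans (Op-resp (suc s) {f} {mono c v} f≈cv ρ) (Op≈ ρ))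
    ... | v' , shape' , result =
      v' , Eq.subst (λ t → Shape t v') (Eq.sym (ℕP.+-suc s l)) shape' ,
      λ ρ → trans (result ρ) (mono-cong v' (*-assoc c (w (suc s)) _) ρ)

  product-++ : ∀ xs ys → product (xs ++ ys) ≈ product xs * product ys
  product-++ []       ys = sym (*-identityˡ _)
  product-++ (x ∷ xs) ys = trans (*-congˡ (product-++ xs ys)) (sym (*-assoc _ _ _))

  product-pairs : ∀ (F : ℕ × ℕ → Carrier) (g : ℕ → List ℕ) xs →
    product (map F (concatMap (λ a → map (λ b → (a , b)) (g a)) xs))
      ≈ product (map (λ a → product (map (λ b → F (a , b)) (g a))) xs)
  product-pairs F g []       = refl
  product-pairs F g (x ∷ xs) = begin
    product (map F (row ++ rest))               ≡⟨ Eq.cong product (ListP.map-++ F row rest) ⟩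
    product (map F row ++ map F rest)           ≈⟨ product-++ (map F row) (map F rest) ⟩
    product (map F row) * product (map F rest)
      ≈⟨ *-cong (reflexive (Eq.cong product (Eq.sym (ListP.map-∘ (g x))))) (product-pairs F g xs) ⟩
    product (map (λ b → F (x , b)) (g x)) * product (map (λ a → product (map (λ b → F (a , b)) (g a))) xs) ∎
    where
    row  = map (λ b → (x , b)) (g x)
    rest = concatMap (λ a → map (λ b → (a , b)) (g a)) xs

  product-cong : ∀ (F F' : ℕ → Carrier) s l → (∀ b → s ℕ.≤ b → b ℕ.< s ℕ.+ l → F b ≈ F' b) →
    product (map F (consecutive s l)) ≈ product (map F' (consecutive s l))
  product-cong F F' s zero    h = refl
  product-cong F F' s (suc l) h =
    *-cong (h s ℕP.≤-refl (ℕP.m<m+n s (s≤s z≤n)))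
           (product-cong F F' (suc s) l (λ b s<b b<end → h b (ℕP.<⇒≤ s<b) (Eq.subst (b ℕ.<_) (Eq.sym (ℕP.+-suc s l)) b<end)))

  product-ones : ∀ (F : ℕ → Carrier) s l → (∀ b → s ℕ.≤ b → F b ≈ 1#) → product (map F (consecutive s l)) ≈ 1#
  product-ones F s zero    h = refl
  product-ones F s (suc l) h =
    trans (*-cong (h s ℕP.≤-refl) (product-ones F (suc s) l (λ b s<b → h b (ℕP.<⇒≤ s<b)))) (*-identityˡ 1#)

  product-single : ∀ (F : ℕ → Carrier) s l x → s ℕ.≤ x → x ℕ.< s ℕ.+ l → (∀ b → ¬ b ≡ x → F b ≈ 1#) →
    product (map F (consecutive s l)) ≈ F x
  product-single F s zero    x s≤x x<s+0 h = ⊥-elim (ℕP.<⇒≱ x<s+0 (ℕP.≤-trans (ℕP.≤-reflexive (ℕP.+-identityʳ s)) s≤x))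
  product-single F s (suc l) x s≤x x<end h with ℕP.m≤n⇒m<n∨m≡n s≤x
  ... | inj₂ Eq.refl = trans (*-congˡ (product-ones F (suc s) l (λ b s<b → h b (λ b≡s → ℕP.<⇒≢ s<b (Eq.sym b≡s)))))
                             (*-identityʳ _)
  ... | inj₁ s<x     = trans (*-cong (h s (ℕP.<⇒≢ s<x))
                                     (product-single F (suc s) l x s<x (Eq.subst (x ℕ.<_) (ℕP.+-suc s l) x<end) h))
                             (*-identityˡ _)

  module Dominant (lam : Exp) (dominant : InA r n lam) (p : ℕ) (p<r : p ℕ.< r) where

    L : ℕ → ℤ
    L = get lam

    last : ℕ
    last = r ℕ.∸ 1

    suc-last : suc last ≡ r
    suc-last = ℕP.suc-pred r {{ℕ.>-nonZero (ℕP.≤-<-trans z≤n p<r)}}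

    below-last : ∀ {a} → a ℕ.< last → suc a ℕ.< r
    below-last a<last = ℕP.<-≤-trans (s≤s a<last) (ℕP.≤-reflexive suc-last)

    decreasing : ∀ {a b} → a ℕ.≤ b → b ℕ.< r → L b ℤ.≤ L a
    decreasing {a} {zero}  z≤n _ = ℤP.≤-refl
    decreasing {a} {suc b} a≤b b<r with ℕP.m≤n⇒m<n∨m≡n a≤b
    ... | inj₁ (s≤s a≤b') = ℤP.≤-trans (proj₁ dominant b b<r) (decreasing a≤b' (ℕP.<-trans (ℕP.n<1+n b) b<r))
    ... | inj₂ Eq.refl    = ℤP.≤-refl

    -- Differences λ_a - λ_b with a ≤ b lie in [0, n]; these are the
    -- pairings met by the sweeps below.
    gap : ∀ {a b} → a ℕ.≤ b → b ℕ.< r → Σ ℕ λ m → L a ℤ.- L b ≡ + m × m ℕ.≤ n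
    gap {a} {b} a≤b b<r = ℤ.∣ d ∣ , Eq.sym d≡∣d∣ , ℤP.drop‿+≤+ (Eq.subst (ℤ._≤ + n) (Eq.sym d≡∣d∣) d≤n)
      where
      d = L a ℤ.- L b
      d≡∣d∣ : + ℤ.∣ d ∣ ≡ d
      d≡∣d∣ = ℤP.0≤i⇒+∣i∣≡i (ℤP.i≤j⇒0≤j-i (decreasing a≤b b<r))
      d≤n : d ℤ.≤ + n
      d≤n = ℤP.≤-trans (ℤP.+-mono-≤ (decreasing z≤n (ℕP.≤-<-trans a≤b b<r))
                                    (ℤP.neg-mono-≤ (decreasing (ℕP.<⇒≤pred b<r) (ℕP.<-≤-trans (ℕP.n<1+n last) (ℕP.≤-reflexive suc-last)))))
                       (proj₂ dominant)

    -- σ-factors collected by T_b (b = p+1, …, r-1) and by T_j^{-1} (j = 1, …, p).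
    forwardWeight : ℕ → Carrier
    forwardWeight b = σpow (L p ℤ.- L b) (+ 1)

    backwardWeight : ℕ → Carrier
    backwardWeight j = σpow (L (ℕ.pred j) ℤ.- L p) -[1+ 0 ]

    -- After T_{p+1}, …, T_a the entry λ_{p+1} sits at (0-based) position a
    -- and λ_{p+2}, …, λ_{a+1} have moved one step to the left.
    record ForwardShape (a : ℕ) (v : Exp) : Set where
      field
        started : p ℕ.≤ a
        below   : ∀ q → q ℕ.< p → get v q ≡ L q
        shifted : ∀ q → p ℕ.≤ q → q ℕ.< a → get v q ≡ L (suc q)
        carried : get v a ≡ L p
        above   : ∀ q → a ℕ.< q → get v q ≡ L q

    forward-step : ∀ a v c → a ℕ.< last → ForwardShape a v →
      ForwardShape (suc a) (swapV (suc a) v)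
      × T (suc a) (mono c v) ≈P mono (c * forwardWeight (suc a)) (swapV (suc a) v)
    forward-step a v c a<last shape with gap (ℕP.m≤n⇒m≤1+n (ForwardShape.started shape)) (below-last a<last)
    ... | m , gap≡m , m≤n = next , reflection
      where
      open ForwardShape shape
      a+1<r : suc a ℕ.< r
      a+1<r = below-last a<last
      pairing≡m : pairing (suc a) v ≡ + m
      pairing≡m = Eq.trans (Eq.cong₂ ℤ._-_ carried (above (suc a) (ℕP.n<1+n a))) gap≡m
      reflection : T (suc a) (mono c v) ≈P mono (c * forwardWeight (suc a)) (swapV (suc a) v)
      reflection ρ = trans (T-forward (suc a) c v m pairing≡m m≤n ρ)
                           (mono-cong (swapV (suc a) v) (*-congˡ (reflexive (Eq.cong (λ t → σpow t (+ 1)) (Eq.sym gap≡m)))) ρ)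
      next : ForwardShape (suc a) (swapV (suc a) v)
      next = record
        { started = ℕP.m≤n⇒m≤1+n started
        ; below   = λ q q<p → Eq.trans (get-swap-other v a q (ℕP.<⇒≢ (ℕP.<-≤-trans q<p started))
                                          (ℕP.<⇒≢ (ℕP.<-≤-trans q<p (ℕP.m≤n⇒m≤1+n started)))) (below q q<p)
        ; shifted = shifted′
        ; carried = Eq.trans (get-swap-right v a a+1<r) carried
        ; above   = λ q a+1<q → Eq.trans (get-swap-other v a q (λ q≡a → ℕP.<⇒≢ (ℕP.<-trans (ℕP.n<1+n a) a+1<q) (Eq.sym q≡a))
                                                             (λ q≡a+1 → ℕP.<⇒≢ a+1<q (Eq.sym q≡a+1)))
                                         (above q (ℕP.<-trans (ℕP.n<1+n a) a+1<q))
        }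
        where
        shifted′ : ∀ q → p ℕ.≤ q → q ℕ.< suc a → get (swapV (suc a) v) q ≡ L (suc q)
        shifted′ q p≤q (s≤s q≤a) with ℕP.m≤n⇒m<n∨m≡n q≤a
        ... | inj₁ q<a     = Eq.trans (get-swap-other v a q (ℕP.<⇒≢ q<a) (ℕP.<⇒≢ (ℕP.m<n⇒m<1+n q<a))) (shifted q p≤q q<a)
        ... | inj₂ Eq.refl = Eq.trans (get-swap-left v q a+1<r) (above (suc q) (ℕP.n<1+n q))

    -- After ω and T_1^{-1}, …, T_s^{-1} the entry λ_{p+1} sits at position
    -- s and λ_{s+1}, …, λ_p are one step to the right of their place.
    record BackwardShape (s : ℕ) (v : Exp) : Set where
      field
        below   : ∀ q → q ℕ.< s → get v q ≡ L q
        carried : get v s ≡ L p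
        shifted : ∀ q → s ℕ.≤ q → q ℕ.< p → get v (suc q) ≡ L q
        above   : ∀ q → p ℕ.< q → get v q ≡ L q

    backward-step : ∀ s v c → s ℕ.< p → BackwardShape s v →
      BackwardShape (suc s) (swapV (suc s) v)
      × Tinv (suc s) (mono c v) ≈P mono (c * backwardWeight (suc s)) (swapV (suc s) v)
    backward-step s v c s<p shape with gap (ℕP.<⇒≤ s<p) p<r
    ... | m , gap≡m , m≤n = next , reflection
      where
      open BackwardShape shape
      s+1<r : suc s ℕ.< r
      s+1<r = ℕP.≤-<-trans s<p p<r
      pairing≡-m : pairing (suc s) v ≡ ℤ.- (+ m)
      pairing≡-m = Eq.trans (Eq.cong₂ ℤ._-_ carried (shifted s ℕP.≤-refl s<p))
                            (Eq.trans (sub-swap (L p) (L s)) (Eq.cong ℤ.-_ gap≡m))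
      reflection : Tinv (suc s) (mono c v) ≈P mono (c * backwardWeight (suc s)) (swapV (suc s) v)
      reflection ρ = trans (T-backward (suc s) c v m pairing≡-m m≤n ρ)
                           (mono-cong (swapV (suc s) v) (*-congˡ (reflexive (Eq.cong (λ t → σpow t -[1+ 0 ]) (Eq.sym gap≡m)))) ρ)
      next : BackwardShape (suc s) (swapV (suc s) v)
      next = record
        { below   = below′
        ; carried = Eq.trans (get-swap-right v s s+1<r) carried
        ; shifted = λ q s+1≤q q<p →
            Eq.trans (get-swap-other v s (suc q) (λ q+1≡s → ℕP.<⇒≢ (ℕP.<-trans (ℕP.n<1+n s) (s≤s s+1≤q)) (Eq.sym q+1≡s))
                                                 (λ q+1≡s+1 → ℕP.<⇒≢ s+1≤q (Eq.sym (ℕP.suc-injective q+1≡s+1))))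
                     (shifted q (ℕP.<⇒≤ s+1≤q) q<p)
        ; above   = λ q p<q →
            Eq.trans (get-swap-other v s q (λ q≡s → ℕP.<⇒≢ (ℕP.<-trans s<p p<q) (Eq.sym q≡s))
                                           (λ q≡s+1 → ℕP.<⇒≢ (ℕP.≤-<-trans s<p p<q) (Eq.sym q≡s+1)))
                     (above q p<q)
        }
        where
        below′ : ∀ q → q ℕ.< suc s → get (swapV (suc s) v) q ≡ L q
        below′ q (s≤s q≤s) with ℕP.m≤n⇒m<n∨m≡n q≤s
        ... | inj₁ q<s     = Eq.trans (get-swap-other v s q (ℕP.<⇒≢ q<s) (ℕP.<⇒≢ (ℕP.m<n⇒m<1+n q<s))) (below q q<s)
        ... | inj₂ Eq.refl = Eq.trans (get-swap-left v q s+1<r) (shifted q ℕP.≤-refl s<p)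

    -- Boundary shapes: x^λ starts the forward sweep, ω turns the end of the
    -- forward sweep into the start of the backward sweep, and the end of
    -- the backward sweep is λ again.

    initial-shape : ForwardShape p lam
    initial-shape = record
      { started = ℕP.≤-refl
      ; below   = λ q _ → Eq.refl
      ; shifted = λ q p≤q q<p → ⊥-elim (ℕP.<⇒≱ q<p p≤q)
      ; carried = Eq.refl
      ; above   = λ q _ → Eq.refl
      }

    rotation-shape : ∀ v → ForwardShape last v → BackwardShape 0 (rotate v)
    rotation-shape v shape = record
      { below   = λ q ()
      ; carried = Eq.trans (get-rotate-zero v) carried
      ; shifted = λ q _ q<p → Eq.trans (get-rotate-suc v q (ℕP.≤-<-trans q<p p<r)) (below q q<p)
      ; above   = above′
      }
      where
      open ForwardShape shape
      above′ : ∀ q → p ℕ.< q → get (rotate v) q ≡ L q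
      above′ (suc q) (s≤s p≤q) with suc q ℕ.<? r
      ... | yes q+1<r = Eq.trans (get-rotate-suc v q q+1<r)
                          (shifted q p≤q (ℕP.≤-pred (ℕP.≤-trans q+1<r (ℕP.≤-reflexive (Eq.sym suc-last)))))
      ... | no  q+1≮r = Eq.trans (get-beyond (rotate v) (suc q) (ℕP.≮⇒≥ q+1≮r))
                          (Eq.sym (get-beyond lam (suc q) (ℕP.≮⇒≥ q+1≮r)))

    final-shape : ∀ v → BackwardShape p v → v ≡ lam
    final-shape v shape = get-extensional v lam agree
      where
      open BackwardShape shape
      agree : ∀ q → q ℕ.< r → get v q ≡ L q
      agree q _ with ℕP.<-cmp q p
      ... | tri< q<p _ _ = below q q<p
      ... | tri≈ _ Eq.refl _ = carried
      ... | tri> _ _ p<q = above q p<q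

    -- The eigenvalue γ(nε_{p+1}; λ).  Only positive roots ε_{a+1} - ε_{b+1}
    -- through position p contribute: those with b = p give the backward
    -- weights, those with a = p the forward weights.

    εp : Exp
    εp = ε (suc p)

    rootFactor : ℕ × ℕ → Carrier
    rootFactor (a , b) = σpow (L a ℤ.- L b) (get εp a ℤ.- get εp b)

    rootFactor-off : ∀ a b → ¬ a ≡ p → ¬ b ≡ p → rootFactor (a , b) ≈ 1#
    rootFactor-off a b a≢p b≢p =
      trans (reflexive (Eq.cong (σpow (L a ℤ.- L b)) (Eq.cong₂ ℤ._-_ (get-basis-other {r} p a a≢p) (get-basis-other {r} p b b≢p))))
            (σ-exponent-zero (L a ℤ.- L b))

    row : ℕ → Carrier
    row a = product (map (λ b → rootFactor (a , b)) (range (suc a) last))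

    row-consecutive : ∀ a → row a ≈ product (map (λ b → rootFactor (a , b)) (consecutive (suc a) (last ℕ.∸ a)))
    row-consecutive a = reflexive (Eq.cong (λ bs → product (map (λ b → rootFactor (a , b)) bs)) (range-consecutive (suc a) last))

    row-end : ∀ {a} → a ℕ.< r → suc a ℕ.+ (last ℕ.∸ a) ≡ r
    row-end a<r = Eq.trans (Eq.cong suc (ℕP.m+[n∸m]≡n (ℕP.<⇒≤pred a<r))) suc-last

    row-before : ∀ a → a ℕ.< p → row a ≈ backwardWeight (suc a)
    row-before a a<p = trans (row-consecutive a) (trans
      (product-single (λ b → rootFactor (a , b)) (suc a) (last ℕ.∸ a) p a<p
         (Eq.subst (p ℕ.<_) (Eq.sym (row-end (ℕP.<-trans a<p p<r))) p<r)
         (λ b b≢p → rootFactor-off a b (ℕP.<⇒≢ a<p) b≢p))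
      (reflexive (Eq.cong (σpow (L a ℤ.- L p)) (Eq.cong₂ ℤ._-_ (get-basis-other {r} p a (ℕP.<⇒≢ a<p)) (get-basis-same {r} p p<r)))))

    row-at : row p ≈ product (map forwardWeight (consecutive (suc p) (last ℕ.∸ p)))
    row-at = trans (row-consecutive p) (product-cong (λ b → rootFactor (p , b)) forwardWeight (suc p) (last ℕ.∸ p)
      (λ b p<b _ → reflexive (Eq.cong (σpow (L p ℤ.- L b))
                          (Eq.cong₂ ℤ._-_ (get-basis-same {r} p p<r) (get-basis-other {r} p b (λ b≡p → ℕP.<⇒≢ p<b (Eq.sym b≡p)))))))

    row-after : ∀ a → p ℕ.< a → row a ≈ 1#
    row-after a p<a = trans (row-consecutive a) (product-ones (λ b → rootFactor (a , b)) (suc a) (last ℕ.∸ a)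
      (λ b a<b → rootFactor-off a b (λ a≡p → ℕP.<⇒≢ p<a (Eq.sym a≡p))
                                     (λ b≡p → ℕP.<⇒≢ (ℕP.<-trans p<a a<b) (Eq.sym b≡p))))

    l₀ : ℕ
    l₀ = last ℕ.∸ p

    p+l₀ : p ℕ.+ l₀ ≡ last
    p+l₀ = ℕP.m+[n∸m]≡n (ℕP.<⇒≤pred p<r)

    forwardProduct backwardProduct : Carrier
    forwardProduct  = product (map forwardWeight (consecutive (suc p) l₀))
    backwardProduct = product (map backwardWeight (consecutive 1 p))

    root-product : product (map rootFactor posRoots) ≈ backwardProduct * forwardProduct
    root-product = begin
      product (map rootFactor posRoots)
        ≈⟨ product-pairs rootFactor (λ a → range (suc a) last) (upTo r) ⟩
      product (map row (upTo r))
        ≡⟨ Eq.cong (λ as → product (map row as)) (Eq.trans (upTo-consecutive r) (Eq.trans (Eq.cong (consecutive 0) r≡p+l₀+1) (consecutive-++ 0 p (suc l₀)))) ⟩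
      product (map row (consecutive 0 p ++ consecutive p (suc l₀)))
        ≡⟨ Eq.cong product (ListP.map-++ row (consecutive 0 p) (consecutive p (suc l₀))) ⟩
      product (map row (consecutive 0 p) ++ map row (consecutive p (suc l₀)))
        ≈⟨ product-++ (map row (consecutive 0 p)) _ ⟩
      product (map row (consecutive 0 p)) * (row p * product (map row (consecutive (suc p) l₀)))
        ≈⟨ *-cong (product-cong row (λ a → backwardWeight (suc a)) 0 p (λ a _ a<p → row-before a a<p))
                  (*-cong row-at (product-ones row (suc p) l₀ row-after)) ⟩
      product (map (λ a → backwardWeight (suc a)) (consecutive 0 p)) * (forwardProduct * 1#)
        ≈⟨ *-cong (reflexive (Eq.cong product (Eq.sym (map-consecutive-suc backwardWeight 0 p)))) (*-identityʳ _) ⟩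
      backwardProduct * forwardProduct ∎
      where
      r≡p+l₀+1 : r ≡ p ℕ.+ suc l₀
      r≡p+l₀+1 = Eq.sym (Eq.trans (ℕP.+-suc p l₀) (Eq.trans (Eq.cong suc p+l₀) suc-last))

    qFactor : Carrier
    qFactor = zpow q q⁻¹ (ℤ.- L p)

    γ-factorisation : γ εp 0ℤ lam ≈ qFactor * (backwardProduct * forwardProduct)
    γ-factorisation = *-cong (reflexive q-exponent) root-product
      where
      q-exponent : zpow q q⁻¹ (ℤ.- (0ℤ ℤ.* + n ℤ.+ dot εp lam)) ≡ qFactor
      q-exponent = Eq.cong (λ t → zpow q q⁻¹ (ℤ.- t))
        (Eq.trans (Eq.cong (ℤ._+ dot εp lam) (ℤP.*-zeroˡ (+ n)))
                  (Eq.trans (ℤP.+-identityˡ _) (dot-basis lam p p<r)))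

    forwardPart : Poly
    forwardPart = foldl (λ g j → T j g) (xpow lam) (consecutive (suc p) l₀)

    Y-sweeps : Y (suc p) (xpow lam) ≡ foldl (λ g j → Tinv j g) (ω forwardPart) (consecutive 1 p)
    Y-sweeps = Eq.cong₂ (λ fwd bwd → foldl (λ g j → Tinv j g) (ω (foldl (λ g j → T j g) (xpow lam) fwd)) bwd)
                        (range-consecutive (suc p) last) (range-consecutive 1 p)

    module Forward  = Sweep T    T-resp    ForwardShape  forwardWeight  last forward-step
    module Backward = Sweep Tinv Tinv-resp BackwardShape backwardWeight p    backward-step

    collected-scalar : ∀ {x} → x ≡ L p →
      1# * forwardProduct * zpow q q⁻¹ (ℤ.- x) * backwardProduct ≈ γ εp 0ℤ lam * 1#
    collected-scalar {x} x≡λp = begin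
      1# * forwardProduct * zpow q q⁻¹ (ℤ.- x) * backwardProduct
                                                      ≈⟨ *-congʳ (*-cong (*-identityˡ _) (reflexive (Eq.cong (λ t → zpow q q⁻¹ (ℤ.- t)) x≡λp))) ⟩
      forwardProduct * qFactor * backwardProduct      ≈⟨ xy∙z≈y∙zx _ _ _ ⟩
      qFactor * (backwardProduct * forwardProduct)    ≈⟨ sym γ-factorisation ⟩
      γ εp 0ℤ lam                                     ≈⟨ sym (*-identityʳ _) ⟩
      γ εp 0ℤ lam * 1#                                ∎

    eigenvalue : Y (suc p) (xpow lam) ≈P scale (γ εp 0ℤ lam) (xpow lam)
    eigenvalue with Forward.sweep l₀ p lam (xpow lam) 1# (ℕP.≤-reflexive p+l₀) initial-shape (λ ρ → refl)
    ... | vF , shapeF , forward≈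
        with Backward.sweep p 0 (rotate vF) (ω forwardPart) (1# * forwardProduct * zpow q q⁻¹ (ℤ.- get vF last))
               ℕP.≤-refl (rotation-shape vF (Eq.subst (λ t → ForwardShape t vF) p+l₀ shapeF))
               (λ ρ → trans (ω-resp {forwardPart} {mono (1# * forwardProduct) vF} forward≈ ρ) (ω-mono _ vF ρ))
    ... | vB , shapeB , backward≈ = λ ρ → begin
      coeff (Y (suc p) (xpow lam)) ρ                        ≡⟨ Eq.cong (λ f → coeff f ρ) Y-sweeps ⟩
      coeff (foldl (λ g j → Tinv j g) (ω forwardPart) (consecutive 1 p)) ρ
                                                            ≈⟨ backward≈ ρ ⟩
      coeff (mono (_ * backwardProduct) vB) ρ               ≡⟨ Eq.cong (λ v → coeff (mono _ v) ρ) (final-shape vB shapeB) ⟩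
      coeff (mono (_ * backwardProduct) lam) ρ              ≈⟨ mono-cong lam (collected-scalar carried-last) ρ ⟩
      coeff (mono (γ εp 0ℤ lam * 1#) lam) ρ                 ∎
      where
      carried-last : get vF last ≡ L p
      carried-last = ForwardShape.carried (Eq.subst (λ t → ForwardShape t vF) p+l₀ shapeF)

proposition3p2 : ∀ {c ℓ} (R : CommutativeRing c ℓ) (r n : ℕ) .{{_ : NonZero n}}
    (P : Params R n) → 2 ≤ r → (lam : Vec ℤ r) → InA r n lam →
    SSV.IsSSV R r n P lam (SSV.xpow R r n P lam)
proposition3p2 R r n P _ lam dominant = leading-coefficient , eigen
  where
  open CommutativeRing R
  open SSV R r n P
  open Development R r n P

  leading-coefficient : coeff (xpow lam) lam ≈ 1#
  leading-coefficient = trans (coeff-self 1# lam []) (+-identityʳ 1#)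

  eigen : ∀ i → 1 ≤ i → i ≤ r → Y i (xpow lam) ≈P scale (γ (ε i) 0ℤ lam) (xpow lam)
  eigen (suc p) _ p<r = Dominant.eigenvalue lam dominant p p<r
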